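{- For every integer $b>2$, there is a tree $T$ with $\beta(T)=b$ and $\tau(T)=2$.
   Context: A set $W$ of vertices of a connected graph is a resolving set if for every pair of distinct vertices $u,v$ there is $w\in W$ with $d(u,w)\neq d(v,w)$, where $d$ is the graph distance; the metric dimension $\beta(H)$ is the minimum size of a resolving set of $H$. The threshold dimension of a graph $G$ is $\tau(G)=\min\{\beta(H): H \text{ contains } G \text{ as a spanning subgraph}\}$. -}

module Defs where

open import Data.Nat using (ℕ; zero; suc; _≤_; _+_)
open import Data.Fin using (Fin; zero; suc; inject₁; fromℕ)
open import Data.Fin.Subset using (Subset; _∈_; ∣_∣)
open import Data.Product using (Σ; ∃; ∃-syntax; _×_; _,_)
open import Data.Empty using (⊥)
open import Relation.Nullary using (¬_)
open import Relation.Binary.PropositionalEquality using (_≡_; _≢_)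
open import Function.Definitions using (Injective)

record Graph (n : ℕ) : Set₁ where
  field
    Adj    : Fin n → Fin n → Set
    sym    : ∀ {u v} → Adj u v → Adj v u
    irrefl : ∀ {u} → ¬ Adj u u
open Graph public

data Walk {n : ℕ} (G : Graph n) : Fin n → Fin n → ℕ → Set where
  here : ∀ {u} → Walk G u u zero
  step : ∀ {u v w k} → Adj G u v → Walk G v w k → Walk G u w (suc k)

Connected : ∀ {n} → Graph n → Set
Connected {n} G = ∀ (u v : Fin n) → ∃[ k ] Walk G u v k

Dist : ∀ {n} → Graph n → Fin n → Fin n → ℕ → Set
Dist G u v k = Walk G u v k × (∀ m → Walk G u v m → k ≤ m)

record Cycle {n : ℕ} (G : Graph n) : Set where
  field
    m         : ℕ
    vtx       : Fin (suc (suc (suc m))) → Fin n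
    distinct  : Injective _≡_ _≡_ vtx
    adjacent  : ∀ (i : Fin (suc (suc m))) → Adj G (vtx (inject₁ i)) (vtx (suc i))
    closing   : Adj G (vtx (fromℕ (suc (suc m)))) (vtx zero)

Acyclic : ∀ {n} → Graph n → Set
Acyclic G = ¬ Cycle G

IsTree : ∀ {n} → Graph n → Set
IsTree {n} G = (1 ≤ n) × Connected G × Acyclic G

Resolving : ∀ {n} → Graph n → Subset n → Set
Resolving {n} G W =
  ∀ (u v : Fin n) → u ≢ v →
    ∃[ w ] (w ∈ W × ∃[ k ] ∃[ l ] (Dist G u w k × Dist G v w l × k ≢ l))

MetricDim : ∀ {n} → Graph n → ℕ → Set
MetricDim {n} G b =
  (∃[ W ] (Resolving G W × ∣ W ∣ ≡ b)) ×
  (∀ (W : Subset n) → Resolving G W → b ≤ ∣ W ∣)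

SpanningSuper : ∀ {n} → Graph n → Graph n → Set
SpanningSuper {n} G H = ∀ (u v : Fin n) → Adj G u v → Adj H u v

ThresholdDim : ∀ {n} → Graph n → ℕ → Set₁
ThresholdDim {n} G t =
  (∃[ H ] (SpanningSuper G H × Connected H × MetricDim H t)) ×
  (∀ (H : Graph n) → SpanningSuper G H → Connected H →
     ∀ (W : Subset n) → Resolving H W → t ≤ ∣ W ∣)

-- T is the comb on the rows top, mid, bot: a spine mid₀ … mid_{b-1} with two
-- leaves topᵢ and botᵢ hanging off each midᵢ. The leaves topᵢ, botᵢ are twins,
-- so every resolving set contains one of them and β(T) ≥ b, while the row of
-- top leaves resolves T. Adding the paths along the top and bottom rows turns T
-- into the 3 × b grid, which the two corners (top,0) and (bot,0) resolve. No
-- supergraph of T has metric dimension 1: if a single landmark w separated mid₀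
-- from its three neighbours, their distances to w would all lie in
-- {d − 1, d + 1} for d = d(mid₀, w), so two neighbours would not be separated.
-- Distances are certified by explicit labellings that are 1-Lipschitz along
-- edges and drop by one along some edge at every vertex but the landmark.
module Submission where

open import Defs hiding (sym)
open import Data.Bool using (true; false)
open import Data.Empty using (⊥; ⊥-elim)
open import Data.Fin using (Fin; zero; suc; toℕ; fromℕ; inject₁; fromℕ<; splitAt; _↑ˡ_; _↑ʳ_)
open import Data.Fin.Properties
  using (toℕ-injective; toℕ<n; toℕ-fromℕ<; toℕ-inject₁;
         splitAt-↑ˡ; splitAt-↑ʳ; splitAt⁻¹-↑ˡ; splitAt⁻¹-↑ʳ)
  renaming (_≟_ to _≟ᶠ_)
open import Data.Fin.Relation.Unary.Top using (view; ‵fromℕ; ‵inject₁)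
open import Data.Fin.Subset using (Subset; _∈_; ∣_∣; ⁅_⁆) renaming (⊥ to ∅; ⊤ to full)
open import Data.Fin.Subset.Properties
  using (_∈?_; ∈⊤; x∈⁅x⁆; x∈⁅y⁆⇒x≡y; ∣⁅x⁆∣≡1; ∣⊤∣≡n; ∣⊥∣≡0; ∣p∣≤∣x∷p∣; drop-there;
         p⊆q⇒∣p∣≤∣q∣; x∈p∧x≢y⇒x∈p-y; x∈p⇒∣p-x∣<∣p∣)
open import Data.List using (allFin)
open import Data.List.Extrema.Nat using (argmax; f[xs]≤f[argmax])
open import Data.List.Membership.Propositional.Properties using (∈-allFin)
import Data.List.Relation.Unary.All as All
open import Data.Nat using (ℕ; zero; suc; pred; _+_; _≤_; _<_; z≤n; s≤s; ∣_-_∣)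
open import Data.Nat.Properties
open import Data.Product using (Σ; ∃; ∃-syntax; _×_; _,_; proj₁; proj₂)
open import Data.Sum using (_⊎_; inj₁; inj₂; [_,_]′)
import Data.Sum as Sum
open import Data.Vec using (_∷_; []; _++_)
import Data.Vec as Vec
open import Data.Vec.Properties using (lookup-++ˡ; lookup-++ʳ; []=⇒lookup; lookup⇒[]=)
open import Function using (_∘_)
open import Relation.Binary.Construct.Closure.Symmetric using (SymClosure; fwd; bwd)
import Relation.Binary.Construct.Closure.Symmetric as SymClosure
open import Relation.Binary.Definitions using (tri<; tri≈; tri>)
open import Relation.Nullary using (¬_; yes; no)
open import Relation.Binary.PropositionalEquality

module Distance {n : ℕ} (G : Graph n) where

  snoc : ∀ {u v w k} → Walk G u v k → Adj G v w → Walk G u w (suc k)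
  snoc here       b = step b here
  snoc (step a p) b = step a (snoc p b)

  reverse : ∀ {u v k} → Walk G u v k → Walk G v u k
  reverse here       = here
  reverse (step a p) = snoc (reverse p) (Graph.sym G a)

  _++ʷ_ : ∀ {u v w k l} → Walk G u v k → Walk G v w l → Walk G u w (k + l)
  here       ++ʷ q = q
  (step a p) ++ʷ q = step a (p ++ʷ q)

  adj⇒≢ : ∀ {u v} → Adj G u v → u ≢ v
  adj⇒≢ a refl = Graph.irrefl G a

  Dist-unique : ∀ {u w k l} → Dist G u w k → Dist G u w l → k ≡ l
  Dist-unique (p , p-minimal) (q , q-minimal) = ≤-antisym (p-minimal _ q) (q-minimal _ p)

  Dist-adjacent : ∀ {u v w k l} → Adj G u v → Dist G u w k → Dist G v w l → l ≤ suc k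
  Dist-adjacent a (p , _) (_ , q-minimal) = q-minimal _ (step (Graph.sym G a) p)

  Dist-twins : ∀ {u v w k l} →
               (∀ {z} → Adj G u z → Adj G v z) → (∀ {z} → Adj G v z → Adj G u z) →
               u ≢ w → v ≢ w → Dist G u w k → Dist G v w l → k ≡ l
  Dist-twins {w = w} u⊆v v⊆u u≢w v≢w (p , p-minimal) (q , q-minimal) =
    ≤-antisym (p-minimal _ (transfer v⊆u v≢w q)) (q-minimal _ (transfer u⊆v u≢w p))
    where
    transfer : ∀ {x y m} → (∀ {z} → Adj G x z → Adj G y z) → x ≢ w → Walk G x w m → Walk G y w m
    transfer x⊆y x≢w here       = ⊥-elim (x≢w refl)
    transfer x⊆y x≢w (step a p) = step (x⊆y a) p

  Separates : Fin n → Fin n → Fin n → Set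
  Separates w u v = ∃[ k ] ∃[ l ] (Dist G u w k × Dist G v w l × k ≢ l)

  Separates⇒≢ : ∀ {w u v k l} → Separates w u v → Dist G u w k → Dist G v w l → k ≢ l
  Separates⇒≢ (_ , _ , Du′ , Dv′ , k′≢l′) Du Dv k≡l =
    k′≢l′ (trans (Dist-unique Du′ Du) (trans k≡l (Dist-unique Dv Dv′)))

  twins⇒∈-resolving : ∀ {W u v} → Resolving G W → u ≢ v →
                      (∀ {z} → Adj G u z → Adj G v z) → (∀ {z} → Adj G v z → Adj G u z) →
                      u ∈ W ⊎ v ∈ W
  twins⇒∈-resolving {W} {u} {v} R u≢v u⊆v v⊆u with u ∈? W | v ∈? W
  ... | yes u∈W | _       = inj₁ u∈W
  ... | no _    | yes v∈W = inj₂ v∈W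
  ... | no u∉W  | no v∉W  with R u v u≢v
  ...   | w , w∈W , k , l , Du , Dv , k≢l =
    ⊥-elim (k≢l (Dist-twins u⊆v v⊆u (λ { refl → u∉W w∈W }) (λ { refl → v∉W w∈W }) Du Dv))

  record DistanceLabelling (w : Fin n) (f : Fin n → ℕ) : Set where
    field
      target    : f w ≡ 0
      lipschitz : ∀ {u v} → Adj G u v → f v ≤ suc (f u)
      descent   : ∀ {u} → u ≢ w → ∃[ v ] (Adj G u v × suc (f v) ≡ f u)

  module _ {w : Fin n} {f : Fin n → ℕ} (L : DistanceLabelling w f) where
    open DistanceLabelling L

    private
      f≤length : ∀ {u m} → Walk G u w m → f u ≤ m
      f≤length here       = ≤-reflexive target
      f≤length (step a p) = ≤-trans (lipschitz (Graph.sym G a)) (s≤s (f≤length p))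

      descending-walk : ∀ k u → f u ≡ k → Walk G u w k
      descending-walk k u fu≡k with u ≟ᶠ w
      ... | yes refl = subst (Walk G w w) (trans (sym target) fu≡k) here
      ... | no u≢w   with descent u≢w
      descending-walk zero    u fu≡0   | no _ | v , _ , fv<fu = ⊥-elim (1+n≢0 (trans fv<fu fu≡0))
      descending-walk (suc k) u fu≡1+k | no _ | v , a , fv<fu =
        step a (descending-walk k v (suc-injective (trans fv<fu fu≡1+k)))

    labelling⇒Dist : ∀ u → Dist G u w (f u)
    labelling⇒Dist u = descending-walk (f u) u refl , λ m p → f≤length p

    labelling⇒Connected : Connected G
    labelling⇒Connected u v =
      f u + f v , proj₁ (labelling⇒Dist u) ++ʷ reverse (proj₁ (labelling⇒Dist v))

∈⇒1≤∣p∣ : ∀ {n} {p : Subset n} {x} → x ∈ p → 1 ≤ ∣ p ∣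
∈⇒1≤∣p∣ {p = p} {x} x∈p =
  subst (_≤ ∣ p ∣) (∣⁅x⁆∣≡1 x)
        (p⊆q⇒∣p∣≤∣q∣ (λ y∈⁅x⁆ → subst (_∈ p) (sym (x∈⁅y⁆⇒x≡y x y∈⁅x⁆)) x∈p))

∈⇒2≤∣p∣ : ∀ {n} {p : Subset n} {x y} → x ∈ p → y ∈ p → x ≢ y → 2 ≤ ∣ p ∣
∈⇒2≤∣p∣ x∈p y∈p x≢y =
  ≤-trans (s≤s (∈⇒1≤∣p∣ (x∈p∧x≢y⇒x∈p-y y∈p (x≢y ∘ sym)))) (x∈p⇒∣p-x∣<∣p∣ x∈p)

∣p++q∣≡∣p∣+∣q∣ : ∀ {m n} (p : Subset m) (q : Subset n) → ∣ p ++ q ∣ ≡ ∣ p ∣ + ∣ q ∣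
∣p++q∣≡∣p∣+∣q∣ []          q = refl
∣p++q∣≡∣p∣+∣q∣ (true  ∷ p) q = cong suc (∣p++q∣≡∣p∣+∣q∣ p q)
∣p++q∣≡∣p∣+∣q∣ (false ∷ p) q = ∣p++q∣≡∣p∣+∣q∣ p q

∈-++⁺ˡ : ∀ {m n} {p : Subset m} (q : Subset n) {x} → x ∈ p → x ↑ˡ n ∈ p ++ q
∈-++⁺ˡ {p = p} q {x} x∈p = lookup⇒[]= _ (p ++ q) (trans (lookup-++ˡ p q x) ([]=⇒lookup x∈p))

∈-++⁺ʳ : ∀ {m n} (p : Subset m) {q : Subset n} {x} → x ∈ q → m ↑ʳ x ∈ p ++ q
∈-++⁺ʳ p {q} {x} x∈q = lookup⇒[]= _ (p ++ q) (trans (lookup-++ʳ p q x) ([]=⇒lookup x∈q))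

∈-++⁻ˡ : ∀ {m n} (p : Subset m) (q : Subset n) {x} → x ↑ˡ n ∈ p ++ q → x ∈ p
∈-++⁻ˡ p q {x} x∈p++q = lookup⇒[]= x p (trans (sym (lookup-++ˡ p q x)) ([]=⇒lookup x∈p++q))

∈-++⁻ʳ : ∀ {m n} (p : Subset m) (q : Subset n) {x} → m ↑ʳ x ∈ p ++ q → x ∈ q
∈-++⁻ʳ p q {x} x∈p++q = lookup⇒[]= x q (trans (sym (lookup-++ʳ p q x)) ([]=⇒lookup x∈p++q))

cover⇒n≤∣p∣+∣q∣ : ∀ {n} (p q : Subset n) → (∀ x → x ∈ p ⊎ x ∈ q) → n ≤ ∣ p ∣ + ∣ q ∣
cover⇒n≤∣p∣+∣q∣ []      []      _     = z≤n
cover⇒n≤∣p∣+∣q∣ {suc n} (s ∷ p) (t ∷ q) cover =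
  head s t (cover zero) (cover⇒n≤∣p∣+∣q∣ p q (Sum.map drop-there drop-there ∘ cover ∘ suc))
  where
  head : ∀ s t → zero ∈ s ∷ p ⊎ zero ∈ t ∷ q → n ≤ ∣ p ∣ + ∣ q ∣ → suc n ≤ ∣ s ∷ p ∣ + ∣ t ∷ q ∣
  head true  t     _        ih = s≤s (≤-trans ih (+-monoʳ-≤ ∣ p ∣ (∣p∣≤∣x∷p∣ t q)))
  head false true  _        ih = ≤-trans (s≤s ih) (≤-reflexive (sym (+-suc ∣ p ∣ ∣ q ∣)))
  head false false (inj₁ ()) _
  head false false (inj₂ ()) _

OffByOne : ℕ → ℕ → Set
OffByOne d k = k ≡ suc d ⊎ suc k ≡ d

≢-near⇒OffByOne : ∀ {d k} → k ≤ suc d → d ≤ suc k → d ≢ k → OffByOne d k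
≢-near⇒OffByOne {d} {k} k≤1+d d≤1+k d≢k with <-cmp k d
... | tri< k<d _   _   = inj₂ (≤-antisym k<d d≤1+k)
... | tri≈ _   k≡d _   = ⊥-elim (d≢k (sym k≡d))
... | tri> _   _   d<k = inj₁ (≤-antisym k≤1+d d<k)

¬three-distinct-OffByOne : ∀ {d k₁ k₂ k₃} → OffByOne d k₁ → OffByOne d k₂ → OffByOne d k₃ →
                           k₁ ≢ k₂ → k₁ ≢ k₃ → k₂ ≢ k₃ → ⊥
¬three-distinct-OffByOne (inj₁ e₁) (inj₁ e₂) _ ≢₁₂ _ _ = ≢₁₂ (trans e₁ (sym e₂))
¬three-distinct-OffByOne (inj₂ e₁) (inj₂ e₂) _ ≢₁₂ _ _ = ≢₁₂ (suc-injective (trans e₁ (sym e₂)))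
¬three-distinct-OffByOne (inj₁ e₁) (inj₂ _) (inj₁ e₃) _ ≢₁₃ _ = ≢₁₃ (trans e₁ (sym e₃))
¬three-distinct-OffByOne (inj₂ e₁) (inj₁ _) (inj₂ e₃) _ ≢₁₃ _ = ≢₁₃ (suc-injective (trans e₁ (sym e₃)))
¬three-distinct-OffByOne (inj₁ _) (inj₂ e₂) (inj₂ e₃) _ _ ≢₂₃ = ≢₂₃ (suc-injective (trans e₂ (sym e₃)))
¬three-distinct-OffByOne (inj₂ _) (inj₁ e₂) (inj₁ e₃) _ _ ≢₂₃ = ≢₂₃ (trans e₂ (sym e₃))

module _ {n : ℕ} (G : Graph n) where
  open Distance G

  private
    ¬separates-star : ∀ {w c a₁ a₂ a₃} → Adj G c a₁ → Adj G c a₂ → Adj G c a₃ →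
                      Separates w c a₁ → Separates w c a₂ → Separates w c a₃ →
                      Separates w a₁ a₂ → Separates w a₁ a₃ → Separates w a₂ a₃ → ⊥
    ¬separates-star {w} {c} c~a₁ c~a₂ c~a₃
      s₁@(d , _ , Dc , D₁ , _) s₂@(_ , _ , _ , D₂ , _) s₃@(_ , _ , _ , D₃ , _) s₁₂ s₁₃ s₂₃ =
      ¬three-distinct-OffByOne (off-by-one c~a₁ D₁ s₁) (off-by-one c~a₂ D₂ s₂) (off-by-one c~a₃ D₃ s₃)
        (Separates⇒≢ s₁₂ D₁ D₂) (Separates⇒≢ s₁₃ D₁ D₃) (Separates⇒≢ s₂₃ D₂ D₃)
      where
      off-by-one : ∀ {a k} → Adj G c a → Dist G a w k → Separates w c a → OffByOne d k
      off-by-one c~a Da s =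
        ≢-near⇒OffByOne (Dist-adjacent c~a Dc Da) (Dist-adjacent (Graph.sym G c~a) Da Dc) (Separates⇒≢ s Dc Da)

    separates⊎2≤∣W∣ : ∀ {W w u v} → Resolving G W → w ∈ W → u ≢ v → Separates w u v ⊎ 2 ≤ ∣ W ∣
    separates⊎2≤∣W∣ {w = w} R w∈W u≢v with R _ _ u≢v
    ... | w′ , w′∈W , s with w′ ≟ᶠ w
    ...   | yes refl = inj₁ s
    ...   | no w′≢w  = inj₂ (∈⇒2≤∣p∣ w′∈W w∈W w′≢w)

  degree-three⇒2≤∣resolving∣ : ∀ {W c a₁ a₂ a₃} → Resolving G W →
                               Adj G c a₁ → Adj G c a₂ → Adj G c a₃ →
                               a₁ ≢ a₂ → a₁ ≢ a₃ → a₂ ≢ a₃ → 2 ≤ ∣ W ∣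
  degree-three⇒2≤∣resolving∣ R c~a₁ c~a₂ c~a₃ a₁≢a₂ a₁≢a₃ a₂≢a₃ with R _ _ a₁≢a₂
  ... | w , w∈W , s₁₂
    with separates⊎2≤∣W∣ R w∈W (adj⇒≢ c~a₁) | separates⊎2≤∣W∣ R w∈W (adj⇒≢ c~a₂)
       | separates⊎2≤∣W∣ R w∈W (adj⇒≢ c~a₃) | separates⊎2≤∣W∣ R w∈W a₁≢a₃
       | separates⊎2≤∣W∣ R w∈W a₂≢a₃
  ... | inj₁ s₁ | inj₁ s₂ | inj₁ s₃ | inj₁ s₁₃ | inj₁ s₂₃ =
    ⊥-elim (¬separates-star c~a₁ c~a₂ c~a₃ s₁ s₂ s₃ s₁₂ s₁₃ s₂₃)
  ... | inj₂ 2≤∣W∣ | _ | _ | _ | _ = 2≤∣W∣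
  ... | _ | inj₂ 2≤∣W∣ | _ | _ | _ = 2≤∣W∣
  ... | _ | _ | inj₂ 2≤∣W∣ | _ | _ = 2≤∣W∣
  ... | _ | _ | _ | inj₂ 2≤∣W∣ | _ = 2≤∣W∣
  ... | _ | _ | _ | _ | inj₂ 2≤∣W∣ = 2≤∣W∣

argmax-Fin : ∀ {k} (f : Fin (suc k) → ℕ) → ∃[ i ] (∀ j → f j ≤ f i)
argmax-Fin {k} f =
  argmax f zero (allFin (suc k)) ,
  λ j → All.lookup (f[xs]≤f[argmax] {f = f} zero (allFin (suc k))) (∈-allFin j)

Cycle-neighbours : ∀ {n} {G : Graph n} (C : Cycle G) → let open Cycle C in
                   ∀ i → ∃[ j ] ∃[ j′ ] (j ≢ j′ × Adj G (vtx i) (vtx j) × Adj G (vtx i) (vtx j′))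
Cycle-neighbours {G = G} C zero =
  suc zero , fromℕ (suc (suc m)) , (λ ()) , adjacent zero , Graph.sym G closing
  where open Cycle C
Cycle-neighbours {G = G} C (suc i) with view i
... | ‵fromℕ =
  inject₁ (fromℕ (suc m)) , zero , (λ ()) , Graph.sym G (adjacent (fromℕ (suc m))) , closing
  where open Cycle C
... | ‵inject₁ j =
  inject₁ (inject₁ j) , suc (suc j) , inject₁²≢suc² ,
  Graph.sym G (adjacent (inject₁ j)) , adjacent (suc j)
  where
  open Cycle C
  inject₁²≢suc² : inject₁ (inject₁ j) ≢ suc (suc j)
  inject₁²≢suc² e = m≢1+n+m (toℕ j) {1}
    (trans (sym (trans (toℕ-inject₁ (inject₁ j)) (toℕ-inject₁ j))) (cong toℕ e))

-- On a cycle, a vertex of maximal depth has two distinct neighbours of no larger depth.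
unique-lower-neighbour⇒acyclic :
  ∀ {n} (G : Graph n) (depth : Fin n → ℕ) →
  (∀ {u v v′} → Adj G u v → Adj G u v′ → depth v ≤ depth u → depth v′ ≤ depth u → v ≡ v′) →
  Acyclic G
unique-lower-neighbour⇒acyclic G depth unique C = at-maximum (argmax-Fin (depth ∘ vtx))
  where
  open Cycle C
  at-maximum : ∃[ i ] (∀ j → depth (vtx j) ≤ depth (vtx i)) → ⊥
  at-maximum (i , maximal) with Cycle-neighbours C i
  ... | j , j′ , j≢j′ , i~j , i~j′ = j≢j′ (distinct (unique i~j i~j′ (maximal j) (maximal j′)))

data Row : Set where
  top mid bot : Row

Cell : Set
Cell = Row × ℕ

col : Cell → ℕ
col = proj₂

data TreeEdge : Cell → Cell → Set where
  top-leaf : ∀ {i} → TreeEdge (top , i) (mid , i)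
  bot-leaf : ∀ {i} → TreeEdge (mid , i) (bot , i)
  spine    : ∀ {i} → TreeEdge (mid , i) (mid , suc i)

data GridEdge : Cell → Cell → Set where
  vertical₁  : ∀ {i} → GridEdge (top , i) (mid , i)
  vertical₂  : ∀ {i} → GridEdge (mid , i) (bot , i)
  horizontal : ∀ {r i} → GridEdge (r , i) (r , suc i)

Tree Grid : Cell → Cell → Set
Tree = SymClosure TreeEdge
Grid = SymClosure GridEdge

TreeEdge⇒GridEdge : ∀ {x y} → TreeEdge x y → GridEdge x y
TreeEdge⇒GridEdge top-leaf = vertical₁
TreeEdge⇒GridEdge bot-leaf = vertical₂
TreeEdge⇒GridEdge spine    = horizontal

-- A DistanceLabelling of the graph induced on the cells of column < b.
record CellLabelling (b : ℕ) (E : Cell → Cell → Set) (t : Cell) (f : Cell → ℕ) : Set where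
  field
    target<b  : col t < b
    target    : f t ≡ 0
    lipschitz : ∀ {x y} → SymClosure E x y → f y ≤ suc (f x)
    descent   : ∀ {x} → x ≢ t → col x < b → ∃[ y ] (col y < b × SymClosure E x y × suc (f y) ≡ f x)

∣1+m-n∣≤1+∣m-n∣ : ∀ m n → ∣ suc m - n ∣ ≤ suc ∣ m - n ∣
∣1+m-n∣≤1+∣m-n∣ zero    zero    = s≤s z≤n
∣1+m-n∣≤1+∣m-n∣ zero    (suc n) = m≤n⇒m≤1+n (n≤1+n n)
∣1+m-n∣≤1+∣m-n∣ (suc m) zero    = ≤-refl
∣1+m-n∣≤1+∣m-n∣ (suc m) (suc n) = ∣1+m-n∣≤1+∣m-n∣ m n

∣m-n∣≤1+∣1+m-n∣ : ∀ m n → ∣ m - n ∣ ≤ suc ∣ suc m - n ∣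
∣m-n∣≤1+∣1+m-n∣ zero    zero    = z≤n
∣m-n∣≤1+∣1+m-n∣ zero    (suc n) = ≤-refl
∣m-n∣≤1+∣1+m-n∣ (suc m) zero    = m≤n⇒m≤1+n (n≤1+n (suc m))
∣m-n∣≤1+∣1+m-n∣ (suc m) (suc n) = ∣m-n∣≤1+∣1+m-n∣ m n

m<n⇒1+∣1+m-n∣≡∣m-n∣ : ∀ {m n} → m < n → suc ∣ suc m - n ∣ ≡ ∣ m - n ∣
m<n⇒1+∣1+m-n∣≡∣m-n∣ {zero}  {suc n} _         = refl
m<n⇒1+∣1+m-n∣≡∣m-n∣ {suc m} {suc n} (s≤s m<n) = m<n⇒1+∣1+m-n∣≡∣m-n∣ m<n

n≤m⇒1+∣m-n∣≡∣1+m-n∣ : ∀ {m n} → n ≤ m → suc ∣ m - n ∣ ≡ ∣ suc m - n ∣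
n≤m⇒1+∣m-n∣≡∣1+m-n∣ {zero}  {zero}  _         = refl
n≤m⇒1+∣m-n∣≡∣1+m-n∣ {suc m} {zero}  _         = refl
n≤m⇒1+∣m-n∣≡∣1+m-n∣ {suc m} {suc n} (s≤s n≤m) = n≤m⇒1+∣m-n∣≡∣1+m-n∣ n≤m

height : Row → ℕ
height top = 0
height mid = 1
height bot = 2

-- A top leaf d ≥ 1 columns away from (top , k) reaches it via the spine in d + 2 steps.
leafDist : ℕ → ℕ
leafDist zero    = zero
leafDist (suc d) = 3 + d

treeDist : ℕ → Cell → ℕ
treeDist k (top , i) = leafDist ∣ i - k ∣
treeDist k (mid , i) = 1 + ∣ i - k ∣
treeDist k (bot , i) = 2 + ∣ i - k ∣

treeDist-diagonal : ∀ r k → treeDist k (r , k) ≡ height r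
treeDist-diagonal top k rewrite ∣n-n∣≡0 k = refl
treeDist-diagonal mid k rewrite ∣n-n∣≡0 k = refl
treeDist-diagonal bot k rewrite ∣n-n∣≡0 k = refl

tree-labelling : ∀ {b k} → k < b → CellLabelling b TreeEdge (top , k) (treeDist k)
tree-labelling {b} {k} k<b = record
  { target<b  = k<b
  ; target    = treeDist-diagonal top k
  ; lipschitz = lipschitz
  ; descent   = descent
  }
  where
  d≤leafDist : ∀ d → d ≤ leafDist d
  d≤leafDist zero    = z≤n
  d≤leafDist (suc d) = s≤s (m≤n+m d 2)

  leafDist≤2+ : ∀ d → leafDist d ≤ 2 + d
  leafDist≤2+ zero    = z≤n
  leafDist≤2+ (suc d) = ≤-refl

  lipschitz : ∀ {x y} → Tree x y → treeDist k y ≤ suc (treeDist k x)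
  lipschitz (fwd top-leaf)    = s≤s (d≤leafDist _)
  lipschitz (bwd top-leaf)    = leafDist≤2+ _
  lipschitz (fwd bot-leaf)    = ≤-refl
  lipschitz (bwd bot-leaf)    = m≤n+m _ 2
  lipschitz (fwd (spine {i})) = s≤s (∣1+m-n∣≤1+∣m-n∣ i k)
  lipschitz (bwd (spine {i})) = s≤s (∣m-n∣≤1+∣1+m-n∣ i k)

  descent : ∀ {x} → x ≢ (top , k) → col x < b →
            ∃[ y ] (col y < b × Tree x y × suc (treeDist k y) ≡ treeDist k x)
  descent {top , i} x≢t i<b with ∣ i - k ∣ in eq
  ... | zero  = ⊥-elim (x≢t (cong (top ,_) (∣m-n∣≡0⇒m≡n eq)))
  ... | suc d = (mid , i) , i<b , fwd top-leaf , cong (2 +_) eq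
  descent {bot , i} _ i<b = (mid , i) , i<b , bwd bot-leaf , refl
  descent {mid , i} _ i<b with <-cmp i k
  ... | tri≈ _ refl _ =
    (top , i) , i<b , bwd top-leaf , cong suc (trans (treeDist-diagonal top i) (sym (∣n-n∣≡0 i)))
  ... | tri< i<k _ _ =
    (mid , suc i) , ≤-<-trans i<k k<b , fwd spine , cong suc (m<n⇒1+∣1+m-n∣≡∣m-n∣ i<k)
  descent {mid , suc i} _ 1+i<b | tri> _ _ (s≤s k≤i) =
    (mid , i) , <-trans (n<1+n i) 1+i<b , bwd spine , cong suc (n≤m⇒1+∣m-n∣≡∣1+m-n∣ k≤i)

treeDist≡0 : ∀ k y → treeDist k y ≡ 0 → y ≡ (top , k)
treeDist≡0 k (top , i) e with ∣ i - k ∣ in eq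
treeDist≡0 k (top , i) refl | zero = cong (top ,_) (∣m-n∣≡0⇒m≡n eq)

treeDist≡1 : ∀ k y → treeDist k y ≡ 1 → y ≡ (mid , k)
treeDist≡1 k (top , i) e with ∣ i - k ∣
treeDist≡1 k (top , i) () | zero
treeDist≡1 k (top , i) () | suc _
treeDist≡1 k (mid , i) e = cong (mid ,_) (∣m-n∣≡0⇒m≡n (suc-injective e))

treeDist-bot≡2 : ∀ k j → treeDist k (bot , j) ≡ 2 → j ≡ k
treeDist-bot≡2 k j e = ∣m-n∣≡0⇒m≡n (suc-injective (suc-injective e))

top-row-separates : ∀ x y → x ≢ y → ∃[ k ] ((k ≡ col x ⊎ k ≡ col y) × treeDist k x ≢ treeDist k y)
top-row-separates (top , i) y x≢y =
  i , inj₁ refl , λ e → x≢y (sym (treeDist≡0 i y (trans (sym e) (treeDist-diagonal top i))))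
top-row-separates x (top , j) x≢y =
  j , inj₂ refl , λ e → x≢y (treeDist≡0 j x (trans e (treeDist-diagonal top j)))
top-row-separates (mid , i) y x≢y =
  i , inj₁ refl , λ e → x≢y (sym (treeDist≡1 i y (trans (sym e) (treeDist-diagonal mid i))))
top-row-separates x (mid , j) x≢y =
  j , inj₂ refl , λ e → x≢y (treeDist≡1 j x (trans e (treeDist-diagonal mid j)))
top-row-separates (bot , i) (bot , j) x≢y =
  i , inj₁ refl , λ e → x≢y (cong (bot ,_) (sym (treeDist-bot≡2 i j (trans (sym e) (treeDist-diagonal bot i)))))

Tree-top⇒bot : ∀ {i z} → Tree (top , i) z → Tree (bot , i) z
Tree-top⇒bot (fwd top-leaf) = bwd bot-leaf

Tree-bot⇒top : ∀ {i z} → Tree (bot , i) z → Tree (top , i) z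
Tree-bot⇒top (bwd bot-leaf) = fwd top-leaf

depth : Cell → ℕ
depth (top , i) = suc i
depth (mid , i) = i
depth (bot , i) = suc i

Tree-lower-neighbour-unique : ∀ {x y y′} → Tree x y → Tree x y′ →
                              depth y ≤ depth x → depth y′ ≤ depth x → y ≡ y′
Tree-lower-neighbour-unique x~y x~y′ y≤x y′≤x =
  trans (lower⇒parent x~y y≤x) (sym (lower⇒parent x~y′ y′≤x))
  where
  parent : Cell → Cell
  parent (top , i) = mid , i
  parent (mid , i) = mid , pred i
  parent (bot , i) = mid , i

  lower⇒parent : ∀ {x y} → Tree x y → depth y ≤ depth x → y ≡ parent x
  lower⇒parent (fwd top-leaf) _   = refl
  lower⇒parent (bwd top-leaf) y≤x = ⊥-elim (1+n≰n y≤x)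
  lower⇒parent (fwd bot-leaf) y≤x = ⊥-elim (1+n≰n y≤x)
  lower⇒parent (bwd bot-leaf) _   = refl
  lower⇒parent (fwd spine)    y≤x = ⊥-elim (1+n≰n y≤x)
  lower⇒parent (bwd spine)    _   = refl

cornerDist : Cell → ℕ
cornerDist (r , i) = height r + i

grid-labelling : ∀ {b} → 0 < b → CellLabelling b GridEdge (top , 0) cornerDist
grid-labelling {b} 0<b = record
  { target<b  = 0<b
  ; target    = refl
  ; lipschitz = lipschitz
  ; descent   = descent
  }
  where
  lipschitz : ∀ {x y} → Grid x y → cornerDist y ≤ suc (cornerDist x)
  lipschitz (fwd vertical₁)            = ≤-refl
  lipschitz (bwd vertical₁)            = m≤n+m _ 2
  lipschitz (fwd vertical₂)            = ≤-refl
  lipschitz (bwd vertical₂)            = m≤n+m _ 2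
  lipschitz (fwd (horizontal {r} {i})) = ≤-reflexive (+-suc (height r) i)
  lipschitz (bwd (horizontal {r} {i})) = ≤-trans (m≤n+m _ 2) (≤-reflexive (cong suc (sym (+-suc (height r) i))))

  descent : ∀ {x} → x ≢ (top , 0) → col x < b →
            ∃[ y ] (col y < b × Grid x y × suc (cornerDist y) ≡ cornerDist x)
  descent {r   , suc i} _   1+i<b = (r , i) , <-trans (n<1+n i) 1+i<b , bwd horizontal , sym (+-suc (height r) i)
  descent {top , zero}  x≢t _     = ⊥-elim (x≢t refl)
  descent {mid , zero}  _   _     = (top , 0) , 0<b , bwd vertical₁ , refl
  descent {bot , zero}  _   _     = (mid , 0) , 0<b , bwd vertical₂ , refl

flipRow : Row → Row
flipRow top = bot
flipRow mid = mid
flipRow bot = top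

flip : Cell → Cell
flip (r , i) = flipRow r , i

flip-involutive : ∀ x → flip (flip x) ≡ x
flip-involutive (top , i) = refl
flip-involutive (mid , i) = refl
flip-involutive (bot , i) = refl

GridEdge-flip : ∀ {x y} → GridEdge x y → Grid (flip x) (flip y)
GridEdge-flip vertical₁  = bwd vertical₂
GridEdge-flip vertical₂  = bwd vertical₁
GridEdge-flip horizontal = fwd horizontal

Grid-flip : ∀ {x y} → Grid x y → Grid (flip x) (flip y)
Grid-flip (fwd e) = GridEdge-flip e
Grid-flip (bwd e) = SymClosure.symmetric GridEdge (GridEdge-flip e)

CellLabelling-flip : ∀ {b t f} → CellLabelling b GridEdge t f → CellLabelling b GridEdge (flip t) (f ∘ flip)
CellLabelling-flip {b} {t} {f} L = record
  { target<b  = target<b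
  ; target    = trans (cong f (flip-involutive t)) target
  ; lipschitz = lipschitz ∘ Grid-flip
  ; descent   = descent′
  }
  where
  open CellLabelling L
  descent′ : ∀ {x} → x ≢ flip t → col x < b →
             ∃[ y ] (col y < b × Grid x y × suc (f (flip y)) ≡ f (flip x))
  descent′ {x} x≢ft x<b with descent (λ fx≡t → x≢ft (trans (sym (flip-involutive x)) (cong flip fx≡t))) x<b
  ... | y , y<b , fx~y , e =
    flip y , y<b , subst (λ z → Grid z (flip y)) (flip-involutive x) (Grid-flip fx~y) ,
    trans (cong (suc ∘ f) (flip-involutive y)) e

cornerDists-injective : ∀ x y → cornerDist x ≡ cornerDist y →
                        cornerDist (flip x) ≡ cornerDist (flip y) → x ≡ y
cornerDists-injective (top , i) (top , j) e _  = cong (top ,_) e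
cornerDists-injective (mid , i) (mid , j) e _  = cong (mid ,_) (suc-injective e)
cornerDists-injective (bot , i) (bot , j) e _  = cong (bot ,_) (suc-injective (suc-injective e))
cornerDists-injective (top , i) (mid , j) e e′ = ⊥-elim (m≢1+n+m i (trans e (cong suc (sym (suc-injective e′)))))
cornerDists-injective (mid , i) (top , j) e e′ = ⊥-elim (m≢1+n+m j (trans (sym e) (cong suc (suc-injective e′))))
cornerDists-injective (top , i) (bot , j) e e′ = ⊥-elim (m≢1+n+m i {3} (trans e (cong (2 +_) (sym e′))))
cornerDists-injective (bot , i) (top , j) e e′ = ⊥-elim (m≢1+n+m i {3} (trans e′ (cong (2 +_) (sym e))))
cornerDists-injective (mid , i) (bot , j) e e′ = ⊥-elim (m≢1+n+m j (trans (sym e′) (cong suc (suc-injective e))))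
cornerDists-injective (bot , i) (mid , j) e e′ = ⊥-elim (m≢1+n+m i (trans e′ (sym e)))

module Cells (b : ℕ) where

  N : ℕ
  N = b + (b + b)

  cell : Fin N → Row × Fin b
  cell u = [ (top ,_) , [ (mid ,_) , (bot ,_) ]′ ∘ splitAt b ]′ (splitAt b u)

  cell⁻¹ : Row × Fin b → Fin N
  cell⁻¹ (top , i) = i ↑ˡ (b + b)
  cell⁻¹ (mid , i) = b ↑ʳ (i ↑ˡ b)
  cell⁻¹ (bot , i) = b ↑ʳ (b ↑ʳ i)

  cell-cell⁻¹ : ∀ x → cell (cell⁻¹ x) ≡ x
  cell-cell⁻¹ (top , i) rewrite splitAt-↑ˡ b i (b + b) = refl
  cell-cell⁻¹ (mid , i) rewrite splitAt-↑ʳ b (b + b) (i ↑ˡ b) | splitAt-↑ˡ b i b = refl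
  cell-cell⁻¹ (bot , i) rewrite splitAt-↑ʳ b (b + b) (b ↑ʳ i) | splitAt-↑ʳ b b i = refl

  cell⁻¹-cell : ∀ u → cell⁻¹ (cell u) ≡ u
  cell⁻¹-cell u with splitAt b u in eq
  ... | inj₁ i = splitAt⁻¹-↑ˡ eq
  ... | inj₂ j with splitAt b j in eq′
  ...   | inj₁ i = trans (cong (b ↑ʳ_) (splitAt⁻¹-↑ˡ eq′)) (splitAt⁻¹-↑ʳ eq)
  ...   | inj₂ i = trans (cong (b ↑ʳ_) (splitAt⁻¹-↑ʳ eq′)) (splitAt⁻¹-↑ʳ eq)

  cell⁻¹-injective : ∀ x y → cell⁻¹ x ≡ cell⁻¹ y → x ≡ y
  cell⁻¹-injective x y e = trans (sym (cell-cell⁻¹ x)) (trans (cong cell e) (cell-cell⁻¹ y))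

  vertex : Fin N → Cell
  vertex u = proj₁ (cell u) , toℕ (proj₂ (cell u))

  vertex<b : ∀ u → col (vertex u) < b
  vertex<b u = toℕ<n (proj₂ (cell u))

  vertex-injective : ∀ {u v} → vertex u ≡ vertex v → u ≡ v
  vertex-injective {u} {v} e = begin
    u               ≡⟨ sym (cell⁻¹-cell u) ⟩
    cell⁻¹ (cell u) ≡⟨ cong cell⁻¹ (cong₂ _,_ (cong proj₁ e) (toℕ-injective (cong proj₂ e))) ⟩
    cell⁻¹ (cell v) ≡⟨ cell⁻¹-cell v ⟩
    v               ∎
    where open ≡-Reasoning

  vertex-cell⁻¹ : ∀ r i → vertex (cell⁻¹ (r , i)) ≡ (r , toℕ i)
  vertex-cell⁻¹ r i = cong (λ x → proj₁ x , toℕ (proj₂ x)) (cell-cell⁻¹ (r , i))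

  vertexAt : ∀ x → col x < b → Fin N
  vertexAt (r , c) c<b = cell⁻¹ (r , fromℕ< c<b)

  vertex-vertexAt : ∀ x (p : col x < b) → vertex (vertexAt x p) ≡ x
  vertex-vertexAt (r , c) p = trans (vertex-cell⁻¹ r (fromℕ< p)) (cong (r ,_) (toℕ-fromℕ< p))

  vertexAt-≢ : ∀ x y (p : col x < b) (q : col y < b) → x ≢ y → vertexAt x p ≢ vertexAt y q
  vertexAt-≢ x y p q x≢y e =
    x≢y (trans (sym (vertex-vertexAt x p)) (trans (cong vertex e) (vertex-vertexAt y q)))

  module Induced (E : Cell → Cell → Set) (irreflexive : ∀ {x} → ¬ E x x) where

    graph : Graph N
    graph = record
      { Adj    = λ u v → SymClosure E (vertex u) (vertex v)
      ; sym    = SymClosure.symmetric E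
      ; irrefl = λ { (fwd e) → irreflexive e ; (bwd e) → irreflexive e }
      }

    open Distance graph

    adjacent : ∀ {u v x y} → vertex u ≡ x → vertex v ≡ y → SymClosure E x y → Adj graph u v
    adjacent refl refl x~y = x~y

    neighbours⊆ : ∀ {u v x y} → vertex u ≡ x → vertex v ≡ y →
                  (∀ {z} → SymClosure E x z → SymClosure E y z) →
                  ∀ {z} → Adj graph u z → Adj graph v z
    neighbours⊆ refl refl x⊆y = x⊆y

    CellLabelling⇒DistanceLabelling : ∀ {t f} (L : CellLabelling b E t f) →
                                      DistanceLabelling (vertexAt t (CellLabelling.target<b L)) (f ∘ vertex)
    CellLabelling⇒DistanceLabelling {t} {f} L = record
      { target    = trans (cong f (vertex-vertexAt t target<b)) target
      ; lipschitz = lipschitz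
      ; descent   = descent′
      }
      where
      open CellLabelling L
      descent′ : ∀ {u} → u ≢ vertexAt t target<b →
                 ∃[ v ] (Adj graph u v × suc (f (vertex v)) ≡ f (vertex u))
      descent′ {u} u≢t
        with descent (λ e → u≢t (vertex-injective (trans e (sym (vertex-vertexAt t target<b))))) (vertex<b u)
      ... | y , y<b , x~y , fy<fx =
        vertexAt y y<b , adjacent refl (vertex-vertexAt y y<b) x~y ,
        trans (cong (suc ∘ f) (vertex-vertexAt y y<b)) fy<fx

    CellLabelling⇒Dist : ∀ {t f} (L : CellLabelling b E t f) →
                         ∀ u → Dist graph u (vertexAt t (CellLabelling.target<b L)) (f (vertex u))
    CellLabelling⇒Dist = labelling⇒Dist ∘ CellLabelling⇒DistanceLabelling

    CellLabelling⇒Connected : ∀ {t f} → CellLabelling b E t f → Connected graph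
    CellLabelling⇒Connected = labelling⇒Connected ∘ CellLabelling⇒DistanceLabelling

module Comb (b : ℕ) (2<b : 2 < b) where
  open Cells b
  module TreeGraph = Induced TreeEdge (λ ())
  module GridGraph = Induced GridEdge (λ ())

  T H : Graph N
  T = TreeGraph.graph
  H = GridGraph.graph

  0<b : 0 < b
  0<b = ≤-trans (s≤s z≤n) 2<b

  1<b : 1 < b
  1<b = ≤-trans (s≤s (s≤s z≤n)) 2<b

  T-isTree : IsTree T
  T-isTree =
    ≤-trans 0<b (m≤m+n b (b + b)) ,
    TreeGraph.CellLabelling⇒Connected (tree-labelling 0<b) ,
    unique-lower-neighbour⇒acyclic T (depth ∘ vertex)
      (λ u~v u~v′ v≤u v′≤u → vertex-injective (Tree-lower-neighbour-unique u~v u~v′ v≤u v′≤u))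

  top-row : Subset N
  top-row = full {b} ++ ∅ {b + b}

  ∣top-row∣≡b : ∣ top-row ∣ ≡ b
  ∣top-row∣≡b = begin
    ∣ full {b} ++ ∅ {b + b} ∣  ≡⟨ ∣p++q∣≡∣p∣+∣q∣ (full {b}) (∅ {b + b}) ⟩
    ∣ full {b} ∣ + ∣ ∅ {b + b} ∣ ≡⟨ cong₂ _+_ (∣⊤∣≡n b) (∣⊥∣≡0 (b + b)) ⟩
    b + 0                      ≡⟨ +-identityʳ b ⟩
    b                          ∎
    where open ≡-Reasoning

  top-row-resolves : Resolving T top-row
  top-row-resolves u v u≢v with top-row-separates (vertex u) (vertex v) (u≢v ∘ vertex-injective)
  ... | k , k-column , separated =
    vertexAt (top , k) k<b , ∈-++⁺ˡ ∅ ∈⊤ , _ , _ , dist u , dist v , separated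
    where
    k<b : k < b
    k<b = [ (λ { refl → vertex<b u }) , (λ { refl → vertex<b v }) ]′ k-column
    dist : ∀ x → Dist T x (vertexAt (top , k) k<b) (treeDist k (vertex x))
    dist = TreeGraph.CellLabelling⇒Dist (tree-labelling k<b)

  top-or-bot∈resolving : ∀ {W} → Resolving T W → ∀ i → cell⁻¹ (top , i) ∈ W ⊎ cell⁻¹ (bot , i) ∈ W
  top-or-bot∈resolving R i =
    Distance.twins⇒∈-resolving T R top≢bot
      (TreeGraph.neighbours⊆ (vertex-cell⁻¹ top i) (vertex-cell⁻¹ bot i) Tree-top⇒bot)
      (TreeGraph.neighbours⊆ (vertex-cell⁻¹ bot i) (vertex-cell⁻¹ top i) Tree-bot⇒top)
    where
    top≢bot : cell⁻¹ (top , i) ≢ cell⁻¹ (bot , i)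
    top≢bot e with cell⁻¹-injective (top , i) (bot , i) e
    ... | ()

  resolving⇒b≤∣W∣ : ∀ W → Resolving T W → b ≤ ∣ W ∣
  resolving⇒b≤∣W∣ W R with Vec.splitAt b W
  ... | tops , rest , refl with Vec.splitAt b rest
  ... | mids , bots , refl = begin
    b                                ≤⟨ cover⇒n≤∣p∣+∣q∣ tops bots cover ⟩
    ∣ tops ∣ + ∣ bots ∣              ≤⟨ +-monoʳ-≤ ∣ tops ∣ (m≤n+m ∣ bots ∣ ∣ mids ∣) ⟩
    ∣ tops ∣ + (∣ mids ∣ + ∣ bots ∣) ≡⟨ cong (∣ tops ∣ +_) (sym (∣p++q∣≡∣p∣+∣q∣ mids bots)) ⟩
    ∣ tops ∣ + ∣ mids ++ bots ∣      ≡⟨ sym (∣p++q∣≡∣p∣+∣q∣ tops (mids ++ bots)) ⟩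
    ∣ tops ++ (mids ++ bots) ∣       ∎
    where
    open ≤-Reasoning
    cover : ∀ i → i ∈ tops ⊎ i ∈ bots
    cover i = Sum.map (∈-++⁻ˡ tops (mids ++ bots)) (∈-++⁻ʳ mids bots ∘ ∈-++⁻ʳ tops (mids ++ bots))
                      (top-or-bot∈resolving R i)

  T⊆H : SpanningSuper T H
  T⊆H u v = SymClosure.map TreeEdge⇒GridEdge

  corner : Fin b
  corner = fromℕ< 0<b

  corners : Subset N
  corners = ⁅ corner ⁆ ++ (∅ {b} ++ ⁅ corner ⁆)

  ∣corners∣≡2 : ∣ corners ∣ ≡ 2
  ∣corners∣≡2 = begin
    ∣ ⁅ corner ⁆ ++ (∅ {b} ++ ⁅ corner ⁆) ∣
      ≡⟨ ∣p++q∣≡∣p∣+∣q∣ ⁅ corner ⁆ (∅ {b} ++ ⁅ corner ⁆) ⟩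
    ∣ ⁅ corner ⁆ ∣ + ∣ ∅ {b} ++ ⁅ corner ⁆ ∣
      ≡⟨ cong (∣ ⁅ corner ⁆ ∣ +_) (∣p++q∣≡∣p∣+∣q∣ (∅ {b}) ⁅ corner ⁆) ⟩
    ∣ ⁅ corner ⁆ ∣ + (∣ ∅ {b} ∣ + ∣ ⁅ corner ⁆ ∣)
      ≡⟨ cong₂ (λ m n → m + (n + m)) (∣⁅x⁆∣≡1 corner) (∣⊥∣≡0 b) ⟩
    2 ∎
    where open ≡-Reasoning

  corners-resolve : Resolving H corners
  corners-resolve u v u≢v with cornerDist (vertex u) ≟ cornerDist (vertex v)
  ... | no ≢₁ =
    vertexAt (top , 0) 0<b , ∈-++⁺ˡ _ (x∈⁅x⁆ corner) , _ , _ , from-top u , from-top v , ≢₁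
    where
    from-top : ∀ x → Dist H x (vertexAt (top , 0) 0<b) (cornerDist (vertex x))
    from-top = GridGraph.CellLabelling⇒Dist (grid-labelling 0<b)
  ... | yes ≡₁ with cornerDist (flip (vertex u)) ≟ cornerDist (flip (vertex v))
  ...   | no ≢₂ =
    vertexAt (bot , 0) 0<b , ∈-++⁺ʳ ⁅ corner ⁆ (∈-++⁺ʳ ∅ (x∈⁅x⁆ corner)) , _ , _ ,
    from-bot u , from-bot v , ≢₂
    where
    from-bot : ∀ x → Dist H x (vertexAt (bot , 0) 0<b) (cornerDist (flip (vertex x)))
    from-bot = GridGraph.CellLabelling⇒Dist (CellLabelling-flip (grid-labelling 0<b))
  ...   | yes ≡₂ = ⊥-elim (u≢v (vertex-injective (cornerDists-injective _ _ ≡₁ ≡₂)))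

  H-connected : Connected H
  H-connected = GridGraph.CellLabelling⇒Connected (grid-labelling 0<b)

  spanning⇒2≤∣resolving∣ : ∀ {H′} → SpanningSuper T H′ → ∀ W → Resolving H′ W → 2 ≤ ∣ W ∣
  spanning⇒2≤∣resolving∣ {H′} T⊆H′ W R =
    degree-three⇒2≤∣resolving∣ H′ R
      (edge 0<b 0<b (bwd top-leaf)) (edge 0<b 0<b (fwd bot-leaf)) (edge 0<b 1<b (fwd spine))
      top₀≢bot₀ top₀≢mid₁ bot₀≢mid₁
    where
    edge : ∀ {x y} (p : col x < b) (q : col y < b) → Tree x y → Adj H′ (vertexAt x p) (vertexAt y q)
    edge {x} {y} p q x~y = T⊆H′ _ _ (TreeGraph.adjacent (vertex-vertexAt x p) (vertex-vertexAt y q) x~y)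
    top₀≢bot₀ : vertexAt (top , 0) 0<b ≢ vertexAt (bot , 0) 0<b
    top₀≢bot₀ = vertexAt-≢ (top , 0) (bot , 0) 0<b 0<b (λ ())
    top₀≢mid₁ : vertexAt (top , 0) 0<b ≢ vertexAt (mid , 1) 1<b
    top₀≢mid₁ = vertexAt-≢ (top , 0) (mid , 1) 0<b 1<b (λ ())
    bot₀≢mid₁ : vertexAt (bot , 0) 0<b ≢ vertexAt (mid , 1) 1<b
    bot₀≢mid₁ = vertexAt-≢ (bot , 0) (mid , 1) 0<b 1<b (λ ())

proposition9 : ∀ (b : ℕ) → 2 < b →
    ∃[ n ] Σ (Graph n) (λ T → IsTree T × MetricDim T b × ThresholdDim T 2)
proposition9 b 2<b =
  N , T , T-isTree ,
  ((top-row , top-row-resolves , ∣top-row∣≡b) , resolving⇒b≤∣W∣) ,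
  ((H , T⊆H , H-connected , (corners , corners-resolve , ∣corners∣≡2) , spanning⇒2≤∣resolving∣ T⊆H) ,
   λ H′ T⊆H′ _ → spanning⇒2≤∣resolving∣ T⊆H′)
  where
  open Cells b using (N)
  open Comb b 2<b
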